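{- Let $J:\mathcal{C}\to\mathcal{D}$, $R:\mathcal{C}\to\mathcal{C}'$, $S:\mathcal{D}\to\mathcal{D}'$, $J':\mathcal{C}'\to\mathcal{D}'$ be functors together with a natural isomorphism $\alpha: S\circ J\cong J'\circ R$. Suppose $S$ preserves pullbacks, $S$ is full, and $R$ is essentially surjective. If $p:\tilde U\to U$ in $\mathcal{D}$ is a weak $J$-relative universe, then $S(p)$ is a weak $J'$-relative universe.
   Context: Full means every morphism $S(a)\to S(b)$ merely has a preimage; essentially surjective means every object of the codomain is merely (propositional truncation) isomorphic to the image of some object. Given $J:\mathcal{C}\to\mathcal{D}$, $p:\tilde U\to U$ in $\mathcal{D}$, $X$ in $\mathcal{C}$ and $f:J(X)\to U$, a $J$-pullback of $p$ along $f$ is an object $X'$ of $\mathcal{C}$ with morphisms $p':X'\to X$ and $Q:J(X')\to\tilde U$ such that $Q;p=J(p');f$ (diagrammatic composition) and this square is a pullback in $\mathcal{D}$. The morphism $p$ is a weak $J$-relative universe if for every $X$ in $\mathcal{C}$ and $f:J(X)\to U$ there merely exists a $J$-pullback of $p$ along $f$. -}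

module Defs where

open import Level using (Level; _⊔_; suc)
open import Relation.Binary.PropositionalEquality using (_≡_)
open import Data.Product using (Σ; Σ-syntax; _×_)

-- Propositions and (impredicatively encoded) propositional truncation,
-- eliminating into propositions of universe level ℓ.
isProp : ∀ {a} → Set a → Set a
isProp P = (x y : P) → x ≡ y

∥_∥[_] : ∀ {a} → Set a → (ℓ : Level) → Set (a ⊔ suc ℓ)
∥ A ∥[ ℓ ] = (P : Set ℓ) → isProp P → (A → P) → P

record Category (o h : Level) : Set (suc (o ⊔ h)) where
  infixr 9 _∘_
  field
    Obj   : Set o
    Hom   : Obj → Obj → Set h
    id    : ∀ {A} → Hom A A
    _∘_   : ∀ {A B C} → Hom B C → Hom A B → Hom A C
    idˡ   : ∀ {A B} (f : Hom A B) → id ∘ f ≡ f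
    idʳ   : ∀ {A B} (f : Hom A B) → f ∘ id ≡ f
    assoc : ∀ {A B C D} (f : Hom C D) (g : Hom B C) (k : Hom A B) →
            (f ∘ g) ∘ k ≡ f ∘ (g ∘ k)

  _⨾_ : ∀ {A B C} → Hom A B → Hom B C → Hom A C
  f ⨾ g = g ∘ f

  IsIso : ∀ {A B} → Hom A B → Set h
  IsIso {A} {B} f = Σ[ g ∈ Hom B A ] ((g ∘ f ≡ id) × (f ∘ g ≡ id))

  Iso : Obj → Obj → Set h
  Iso A B = Σ[ f ∈ Hom A B ] IsIso f

  -- The commuting square  q ; p = p' ; f  (q : P → Ũ, p : Ũ → U, p' : P → A, f : A → U)
  -- is a pullback square.
  IsPullback : ∀ {P A Ũ U} (p : Hom Ũ U) (f : Hom A U) (p' : Hom P A) (q : Hom P Ũ) → Set (o ⊔ h)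
  IsPullback {P} {A} {Ũ} {U} p f p' q =
    (q ⨾ p ≡ p' ⨾ f) ×
    ((W : Obj) (a : Hom W A) (b : Hom W Ũ) → b ⨾ p ≡ a ⨾ f →
      Σ[ u ∈ Hom W P ] (((u ⨾ p' ≡ a) × (u ⨾ q ≡ b)) ×
        ((u' : Hom W P) → u' ⨾ p' ≡ a → u' ⨾ q ≡ b → u' ≡ u)))

open Category

record Functor {o₁ h₁ o₂ h₂} (C : Category o₁ h₁) (D : Category o₂ h₂)
       : Set (o₁ ⊔ h₁ ⊔ o₂ ⊔ h₂) where
  field
    F₀    : Obj C → Obj D
    F₁    : ∀ {A B} → Hom C A B → Hom D (F₀ A) (F₀ B)
    F-id  : ∀ {A} → F₁ (id C {A}) ≡ id D
    F-∘   : ∀ {A B E} (g : Hom C B E) (f : Hom C A B) →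
            F₁ (_∘_ C g f) ≡ _∘_ D (F₁ g) (F₁ f)

open Functor

_○_ : ∀ {o₁ h₁ o₂ h₂ o₃ h₃} {C : Category o₁ h₁} {D : Category o₂ h₂} {E : Category o₃ h₃} →
      Functor D E → Functor C D → Functor C E
_○_ {C = C} {D} {E} G F = record
  { F₀ = λ X → F₀ G (F₀ F X)
  ; F₁ = λ f → F₁ G (F₁ F f)
  ; F-id = trans (cong (F₁ G) (F-id F)) (F-id G)
  ; F-∘ = λ g f → trans (cong (F₁ G) (F-∘ F g f)) (F-∘ G (F₁ F g) (F₁ F f))
  }
  where open import Relation.Binary.PropositionalEquality using (trans; cong)

record NatIso {o₁ h₁ o₂ h₂} {C : Category o₁ h₁} {D : Category o₂ h₂}
       (F G : Functor C D) : Set (o₁ ⊔ h₁ ⊔ h₂) where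
  field
    η       : (X : Obj C) → Hom D (F₀ F X) (F₀ G X)
    η-iso   : (X : Obj C) → IsIso D (η X)
    natural : ∀ {X Y} (f : Hom C X Y) →
              _∘_ D (η Y) (F₁ F f) ≡ _∘_ D (F₁ G f) (η X)

module _ {o₁ h₁ o₂ h₂} {C : Category o₁ h₁} {D : Category o₂ h₂} where

  PreservesPullbacks : Functor C D → Set (o₁ ⊔ h₁ ⊔ o₂ ⊔ h₂)
  PreservesPullbacks F =
    ∀ {P A Ũ U} (p : Hom C Ũ U) (f : Hom C A U) (p' : Hom C P A) (q : Hom C P Ũ) →
    IsPullback C p f p' q → IsPullback D (F₁ F p) (F₁ F f) (F₁ F p') (F₁ F q)

  Full : (ℓ : Level) → Functor C D → Set (o₁ ⊔ h₁ ⊔ h₂ ⊔ suc ℓ)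
  Full ℓ F = ∀ (a b : Obj C) (g : Hom D (F₀ F a) (F₀ F b)) →
             ∥ Σ[ f ∈ Hom C a b ] (F₁ F f ≡ g) ∥[ ℓ ]

  EssSurj : (ℓ : Level) → Functor C D → Set (o₁ ⊔ o₂ ⊔ h₂ ⊔ suc ℓ)
  EssSurj ℓ F = ∀ (Y : Obj D) → ∥ Σ[ X ∈ Obj C ] Iso D (F₀ F X) Y ∥[ ℓ ]

  record JPullback (J : Functor C D) {Ũ U : Obj D} (p : Hom D Ũ U)
                   (X : Obj C) (f : Hom D (F₀ J X) U) : Set (o₁ ⊔ h₁ ⊔ o₂ ⊔ h₂) where
    field
      X'   : Obj C
      p'   : Hom C X' X
      Q    : Hom D (F₀ J X') Ũ
      isPB : IsPullback D p f (F₁ J p') Q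

  WeakRelUniverse : (ℓ : Level) (J : Functor C D) {Ũ U : Obj D} (p : Hom D Ũ U) →
                    Set (o₁ ⊔ h₁ ⊔ o₂ ⊔ h₂ ⊔ suc ℓ)
  WeakRelUniverse ℓ J {Ũ} {U} p =
    ∀ (X : Obj C) (f : Hom D (F₀ J X) U) → ∥ JPullback J p X f ∥[ ℓ ]

module Submission where

open import Defs
open import Level using (Level; _⊔_)
open import Relation.Binary.PropositionalEquality
open import Data.Product using (_,_; proj₁; proj₂)

-- Given f' : J'(Y) → S(U), essential surjectivity of R gives R(X) ≅ Y, so
-- precomposing with J'(R X) ≅ J'(Y) and α gives S(J X) → S(U), which by
-- fullness is S(h) for some h : J(X) → U. A J-pullback of p along h is sent
-- by S to a pullback of S(p) along S(h); replacing its base corner by J'(Y)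
-- and its apex by J'(R X') via these isomorphisms (pullbacks are invariant
-- under both) yields a J'-pullback of S(p) along f'.

∣_∣ : ∀ {a ℓ} {A : Set a} → A → ∥ A ∥[ ℓ ]
∣ x ∣ P _ k = k x

∥∥-bind : ∀ {a b ℓ} {A : Set a} {B : Set b} →
          ∥ A ∥[ ℓ ] → (A → ∥ B ∥[ ℓ ]) → ∥ B ∥[ ℓ ]
∥∥-bind a f P isPropP k = a P isPropP λ x → f x P isPropP k

module CategoryProperties {o h} (𝒞 : Category o h) where
  open Category 𝒞

  cancelˡ : ∀ {A B E} {g : Hom B A} {k : Hom A B} (x : Hom E A) →
            g ∘ k ≡ id → g ∘ (k ∘ x) ≡ x
  cancelˡ {g = g} {k} x gk = trans (sym (assoc g k x)) (trans (cong (_∘ x) gk) (idˡ x))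

  IsIso-inverse : ∀ {A B} {f : Hom A B} (iso : IsIso f) → IsIso (proj₁ iso)
  IsIso-inverse {f = f} (_ , fl , fr) = f , fr , fl

  IsIso-∘ : ∀ {A B E} {f : Hom B E} {g : Hom A B} → IsIso f → IsIso g → IsIso (f ∘ g)
  IsIso-∘ {f = f} {g} (fi , fl , fr) (gi , gl , gr) =
    gi ∘ fi ,
    trans (assoc gi fi (f ∘ g)) (trans (cong (gi ∘_) (cancelˡ g fl)) gl) ,
    trans (assoc f g (gi ∘ fi)) (trans (cong (f ∘_) (cancelˡ fi gr)) fr)

  IsPullback-isoBase : ∀ {P A A' Ũ U} {p : Hom Ũ U} {f' : Hom A' U} {k : Hom A A'}
                         {p' : Hom P A} {q : Hom P Ũ} →
                       IsIso k → IsPullback p (f' ∘ k) p' q → IsPullback p f' (k ∘ p') q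
  IsPullback-isoBase {f' = f'} {k = k} {p' = p'} (ki , kl , kr) (comm , univ) =
    trans comm (assoc f' k p') , λ W a b eq →
      let (u , (u-p' , u-q) , unique) = univ W (ki ∘ a) b (trans eq (sym (f'k-ki a)))
      in u , (trans (assoc k p' u) (trans (cong (k ∘_) u-p') (cancelˡ a kr)) , u-q) ,
         λ u' u'-p' u'-q → unique u'
           (trans (sym (cancelˡ (p' ∘ u') kl)) (cong (ki ∘_) (trans (sym (assoc k p' u')) u'-p')))
           u'-q
    where
    f'k-ki : ∀ {W} (a : Hom W _) → (f' ∘ k) ∘ (ki ∘ a) ≡ f' ∘ a
    f'k-ki a = trans (assoc f' k (ki ∘ a)) (cong (f' ∘_) (cancelˡ a kr))

  IsPullback-isoApex : ∀ {P P' A Ũ U} {p : Hom Ũ U} {f : Hom A U} {p' : Hom P A}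
                         {q : Hom P Ũ} {i : Hom P' P} →
                       IsIso i → IsPullback p f p' q → IsPullback p f (p' ∘ i) (q ∘ i)
  IsPullback-isoApex {p = p} {f} {p'} {q} {i} (ii , il , ir) (comm , univ) =
    trans (sym (assoc p q i)) (trans (cong (_∘ i) comm) (assoc f p' i)) , λ W a b eq →
      let (u , (u-p' , u-q) , unique) = univ W a b eq
      in ii ∘ u ,
         (trans (assoc p' i (ii ∘ u)) (trans (cong (p' ∘_) (cancelˡ u ir)) u-p') ,
          trans (assoc q i (ii ∘ u)) (trans (cong (q ∘_) (cancelˡ u ir)) u-q)) ,
         λ u' u'-p' u'-q →
           let iu'≡u = unique (i ∘ u') (trans (sym (assoc p' i u')) u'-p')
                                       (trans (sym (assoc q i u')) u'-q)
           in trans (sym (cancelˡ u' il)) (cong (ii ∘_) iu'≡u)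

open Category
open Functor
open NatIso

module _ {o₁ h₁ o₂ h₂} {C : Category o₁ h₁} {D : Category o₂ h₂} where

  F-resp-IsIso : (F : Functor C D) {A B : Obj C} {f : Hom C A B} →
                 IsIso C f → IsIso D (F₁ F f)
  F-resp-IsIso F {f = f} (fi , fl , fr) =
    F₁ F fi ,
    trans (sym (F-∘ F fi f)) (trans (cong (F₁ F) fl) (F-id F)) ,
    trans (sym (F-∘ F f fi)) (trans (cong (F₁ F) fr) (F-id F))

  natural-conjugate : {F G : Functor C D} (α : NatIso F G) {X Y : Obj C} (f : Hom C X Y) →
                      _∘_ D (_∘_ D (η α Y) (F₁ F f)) (proj₁ (η-iso α X)) ≡ F₁ G f
  natural-conjugate {F} {G} α {X} {Y} f = begin
    (η α Y ∘ᴰ F₁ F f) ∘ᴰ ηX⁻¹  ≡⟨ cong (_∘ᴰ ηX⁻¹) (natural α f) ⟩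
    (F₁ G f ∘ᴰ η α X) ∘ᴰ ηX⁻¹  ≡⟨ assoc D (F₁ G f) (η α X) ηX⁻¹ ⟩
    F₁ G f ∘ᴰ (η α X ∘ᴰ ηX⁻¹)  ≡⟨ cong (F₁ G f ∘ᴰ_) (proj₂ (proj₂ (η-iso α X))) ⟩
    F₁ G f ∘ᴰ id D             ≡⟨ idʳ D (F₁ G f) ⟩
    F₁ G f                     ∎
    where
    open ≡-Reasoning
    open Category D using () renaming (_∘_ to _∘ᴰ_)
    ηX⁻¹ : Hom D (F₀ G X) (F₀ F X)
    ηX⁻¹ = proj₁ (η-iso α X)

module _ {o₁ h₁ o₂ h₂ o₃ h₃ o₄ h₄}
         {C : Category o₁ h₁} {D : Category o₂ h₂} {C' : Category o₃ h₃} {D' : Category o₄ h₄}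
         (J : Functor C D) (R : Functor C C') (S : Functor D D') (J' : Functor C' D')
         (α : NatIso (S ○ J) (J' ○ R)) where
  open Category D' using () renaming (_∘_ to _∘'_)
  open CategoryProperties D'

  JPullback-transport :
    PreservesPullbacks S →
    ∀ {Ũ U} (p : Hom D Ũ U) {X Y} {e : Hom C' (F₀ R X) Y} → IsIso C' e →
    (f' : Hom D' (F₀ J' Y) (F₀ S U)) (h : Hom D (F₀ J X) U) →
    F₁ S h ≡ f' ∘' (F₁ J' e ∘' η α X) →
    JPullback J p X h → JPullback J' (F₁ S p) Y f'
  JPullback-transport preservesPB p {X} {e = e} e-iso f' h Sh-factors pb = record
    { X'   = F₀ R X₀
    ; p'   = _∘_ C' e (F₁ R p')
    ; Q    = F₁ S Q ∘' ηX₀⁻¹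
    ; isPB = subst (λ g → IsPullback D' (F₁ S p) f' g (F₁ S Q ∘' ηX₀⁻¹)) leg≡
               (IsPullback-isoApex (IsIso-inverse (η-iso α X₀))
                 (IsPullback-isoBase (IsIso-∘ (F-resp-IsIso J' e-iso) (η-iso α X))
                   (subst (λ g → IsPullback D' (F₁ S p) g (F₁ S (F₁ J p')) (F₁ S Q)) Sh-factors
                     (preservesPB p h (F₁ J p') Q isPB))))
    }
    where
    open JPullback pb renaming (X' to X₀)
    open ≡-Reasoning

    ηX₀⁻¹ : Hom D' (F₀ J' (F₀ R X₀)) (F₀ S (F₀ J X₀))
    ηX₀⁻¹ = proj₁ (η-iso α X₀)

    leg≡ : ((F₁ J' e ∘' η α X) ∘' F₁ S (F₁ J p')) ∘' ηX₀⁻¹ ≡ F₁ J' (_∘_ C' e (F₁ R p'))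
    leg≡ = begin
      ((F₁ J' e ∘' η α X) ∘' F₁ S (F₁ J p')) ∘' ηX₀⁻¹
        ≡⟨ cong (_∘' ηX₀⁻¹) (assoc D' (F₁ J' e) (η α X) (F₁ S (F₁ J p'))) ⟩
      (F₁ J' e ∘' (η α X ∘' F₁ S (F₁ J p'))) ∘' ηX₀⁻¹
        ≡⟨ assoc D' (F₁ J' e) (η α X ∘' F₁ S (F₁ J p')) ηX₀⁻¹ ⟩
      F₁ J' e ∘' ((η α X ∘' F₁ S (F₁ J p')) ∘' ηX₀⁻¹)
        ≡⟨ cong (F₁ J' e ∘'_) (natural-conjugate α p') ⟩
      F₁ J' e ∘' F₁ J' (F₁ R p')
        ≡⟨ sym (F-∘ J' e (F₁ R p')) ⟩
      F₁ J' (_∘_ C' e (F₁ R p'))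
        ∎

mainTheorem9 : ∀ {o₁ h₁ o₂ h₂ o₃ h₃ o₄ h₄ : Level}
    {C : Category o₁ h₁} {D : Category o₂ h₂}
    {C' : Category o₃ h₃} {D' : Category o₄ h₄}
    (J : Functor C D) (R : Functor C C') (S : Functor D D') (J' : Functor C' D')
    (α : NatIso (S ○ J) (J' ○ R)) →
    PreservesPullbacks S →
    Full (o₁ ⊔ h₁ ⊔ o₂ ⊔ h₂ ⊔ o₃ ⊔ h₃ ⊔ o₄ ⊔ h₄) S →
    EssSurj (o₁ ⊔ h₁ ⊔ o₂ ⊔ h₂ ⊔ o₃ ⊔ h₃ ⊔ o₄ ⊔ h₄) R →
    ∀ {Ũ U : Category.Obj D} (p : Category.Hom D Ũ U) →
    WeakRelUniverse (o₁ ⊔ h₁ ⊔ o₂ ⊔ h₂ ⊔ o₃ ⊔ h₃ ⊔ o₄ ⊔ h₄) J p →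
    WeakRelUniverse (o₁ ⊔ h₁ ⊔ o₂ ⊔ h₂ ⊔ o₃ ⊔ h₃ ⊔ o₄ ⊔ h₄) J' (Functor.F₁ S p)
mainTheorem9 {D' = D'} J R S J' α preservesPB full essSurj {U = U} p universe Y f' =
  ∥∥-bind (essSurj Y) λ { (X , e , e-iso) →
    ∥∥-bind (full (F₀ J X) U (_∘_ D' f' (_∘_ D' (F₁ J' e) (η α X)))) λ { (h , Sh-factors) →
      ∥∥-bind (universe X h) λ pb →
        ∣ JPullback-transport J R S J' α preservesPB p e-iso f' h Sh-factors pb ∣ } }
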